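{- Let $(\mathcal A,<_A)$ and $(\mathcal B,<_B)$ be ordered graphs, $a\in A$, $b\in B$, and let $k'<k$ be natural numbers. If $\mathds{C}^k_{(\mathcal A,<_A)}(a)=\mathds{C}^k_{(\mathcal B,<_B)}(b)$, then $\mathds{C}^{k'}_{(\mathcal A,<_A)}(a)=\mathds{C}^{k'}_{(\mathcal B,<_B)}(b)$.
   Context: Ordered graphs are finite structures over $\{E,P_1,\dots,P_N,<\}$ with $E$ symmetric loopless, $P_\ell$ unary colours, $<$ a linear order. $N^k(v)$ denotes the set of vertices at graph distance at most $k$ from $v$. For $B\subseteq A$ and $a<b$ in $B$ consecutive in $B$ (no element of $B$ strictly between), the interval $]a,b[$ is the set of elements of $A$ strictly between $a$ and $b$; $\mathrm{Int}(B)$ is the set of these $|B|-1$ intervals. $k$-contexts are defined recursively: $\mathds{C}^0_{(\mathcal A,<)}(v)$ is the colour (atomic type) of $v$. For $k\ge1$, $\mathds{C}^k_{(\mathcal A,<)}(v)=\big((\mathcal A,<)|_{N^k(v)},\,g,\,f\big)$ where $(\mathcal A,<)|_{N^k(v)}$ is the induced ordered coloured substructure on $N^k(v)$ (with centre $v$), $g$ maps each $a\in N^k(v)$ to $\mathds{C}^{k-1}_{(\mathcal A,<)}(a)$, and $f$ maps each interval $I\in\mathrm{Int}(N^k(v))$ to the set $\{\mathds{C}^{k-1}_{(\mathcal A,<)}(x):x\in I\}$. Contexts are compared up to isomorphism: two $k$-contexts are equal if there is an isomorphism of the ordered coloured neighbourhood structures mapping centre to centre under which the $g$-values and the $f$-values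 of corresponding intervals coincide. -}

module Defs where

open import Data.Nat using (ℕ; zero; suc)
open import Data.Fin using (Fin)
open import Data.Product using (Σ; ∃; _×_; _,_)
open import Data.Sum using (_⊎_)
open import Relation.Nullary using (¬_)
open import Relation.Binary.PropositionalEquality using (_≡_)
open import Relation.Binary.Structures using (IsStrictTotalOrder)
open import Level using (0ℓ)

_⟺_ : Set → Set → Set
P ⟺ Q = (P → Q) × (Q → P)

record OrderedGraph (N : ℕ) : Set₁ where
  field
    size    : ℕ
    E       : Fin size → Fin size → Set
    E-sym   : ∀ {u v} → E u v → E v u
    E-irr   : ∀ {u} → ¬ E u u
    P       : Fin N → Fin size → Set
    _<_     : Fin size → Fin size → Set
    <-isSTO : IsStrictTotalOrder _≡_ _<_

  V : Set
  V = Fin size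

  Dist≤ : ℕ → V → V → Set
  Dist≤ zero    u v = u ≡ v
  Dist≤ (suc k) u v = Dist≤ k u v ⊎ Σ V (λ w → E u w × Dist≤ k w v)

  InNbhd : ℕ → V → V → Set
  InNbhd k v x = Dist≤ k v x

  Consecutive : ℕ → V → V → V → Set
  Consecutive k v x y =
    InNbhd k v x × InNbhd k v y × x < y ×
    (∀ z → InNbhd k v z → x < z → ¬ (z < y))

  Between : V → V → V → Set
  Between x y z = x < z × z < y

open OrderedGraph

-- Equality of k-contexts: CtxEq k A a B b  means  C^k_A(a) = C^k_B(b)
-- (equality up to isomorphism, as in the paper).
CtxEq : ∀ {N} → ℕ → (A : OrderedGraph N) → V A → (B : OrderedGraph N) → V B → Set
CtxEq zero A a B b = ∀ ℓ → P A ℓ a ⟺ P B ℓ b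
-- (k+1)-contexts: an isomorphism h : N^{k+1}(a) → N^{k+1}(b) (with inverse h⁻)
-- of the induced ordered coloured substructures, sending a to b, preserving
-- the k-contexts of all neighbourhood elements (g), and for every interval
-- ]x,y[ of consecutive elements of N^{k+1}(a), the set of k-contexts in ]x,y[
-- equals the set of k-contexts in ]h x, h y[ (f).
CtxEq (suc k) A a B b =
  Σ (V A → V B) λ h → Σ (V B → V A) λ h⁻ →
    (∀ x → InNbhd A (suc k) a x → InNbhd B (suc k) b (h x)) ×
    (∀ y → InNbhd B (suc k) b y → InNbhd A (suc k) a (h⁻ y)) ×
    (∀ x → InNbhd A (suc k) a x → h⁻ (h x) ≡ x) ×
    (∀ y → InNbhd B (suc k) b y → h (h⁻ y) ≡ y) ×
    (h a ≡ b) ×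
    (∀ x y → InNbhd A (suc k) a x → InNbhd A (suc k) a y →
       E A x y ⟺ E B (h x) (h y)) ×
    (∀ x y → InNbhd A (suc k) a x → InNbhd A (suc k) a y →
       _<_ A x y ⟺ _<_ B (h x) (h y)) ×
    (∀ x → InNbhd A (suc k) a x → ∀ ℓ → P A ℓ x ⟺ P B ℓ (h x)) ×
    (∀ x → InNbhd A (suc k) a x → CtxEq k A x B (h x)) ×
    (∀ x y → Consecutive A (suc k) a x y →
       (∀ z → Between A x y z →
          Σ (V B) λ z' → Between B (h x) (h y) z' × CtxEq k A z B z') ×
       (∀ z' → Between B (h x) (h y) z' →
          Σ (V A) λ z → Between A x y z × CtxEq k A z B z'))

module Submission where

open import Defs
open import Data.Nat using (ℕ; zero; suc; _<_; _≤′_; ≤′-refl; ≤′-step)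
open import Data.Nat.Properties using (≤⇒≤′; <⇒≤)
open import Data.Product using (_,_)
open import Data.Sum using (inj₁)
open import Relation.Binary.PropositionalEquality using (refl; subst)

open OrderedGraph using (V; Dist≤)

Dist≤-refl : ∀ {N} (A : OrderedGraph N) k (u : V A) → Dist≤ A k u u
Dist≤-refl A zero    u = refl
Dist≤-refl A (suc k) u = inj₁ (Dist≤-refl A k u)

-- The centre lies in its own neighbourhood, so the g-component of a (k+1)-context
-- equality at the centre is the k-context equality, transported along h a ≡ b.
CtxEq-suc⇒CtxEq : ∀ {N} {A B : OrderedGraph N} {a : V A} {b : V B} {k} →
                  CtxEq (suc k) A a B b → CtxEq k A a B b
CtxEq-suc⇒CtxEq {A = A} {B} {a} {k = k} (_ , _ , _ , _ , _ , _ , ha , _ , _ , _ , g , _) =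
  subst (CtxEq k A a B) ha (g a (Dist≤-refl A (suc k) a))

CtxEq-antimono : ∀ {N} {A B : OrderedGraph N} {a : V A} {b : V B} {k′ k} →
                 k′ ≤′ k → CtxEq k A a B b → CtxEq k′ A a B b
CtxEq-antimono ≤′-refl        c = c
CtxEq-antimono (≤′-step k′≤k) c = CtxEq-antimono k′≤k (CtxEq-suc⇒CtxEq c)

mainTheorem7 : ∀ {N : ℕ} (A B : OrderedGraph N) (a : OrderedGraph.V A) (b : OrderedGraph.V B)
    (k′ k : ℕ) → k′ < k → CtxEq k A a B b → CtxEq k′ A a B b
mainTheorem7 A B a b k′ k k′<k = CtxEq-antimono (≤⇒≤′ (<⇒≤ k′<k))
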